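{- There is no $d<\omega$ such that every finite partial order (of finite width), viewed as a structure in the language $\{<\}$, has the VCd property.
   Context: A partial order has width $n$ if every antichain has at most $n$ elements. For a set $\Delta(x;y)$ of partitioned formulas and $B\subseteq M^{|y|}$, $S^\Delta(B)$ denotes the set of $\Delta$-types over $B$. A family $(\phi_\#(y))_{\phi\in\Delta}$ of formulas with parameters defines $q\in S^\Delta(B)$ if for all $\phi\in\Delta$, $b\in B$: $\phi(x;b)\in q\iff M\models\phi_\#(b)$. $\Delta(x;y)$ has UDTFS in $d$ parameters in $M$ if there are finitely many families $\mathcal{F}_i=(\phi_i(y;y_1,\dots,y_d))_{\phi\in\Delta}$, $i\le m$, of formulas with $|y_j|=|y|$, such that for every finite $B\subseteq M^{|y|}$ and $q\in S^\Delta(B)$ there are $b_1,\dots,b_d\in B$ and $i\le m$ with $\mathcal{F}_i(y;b_1,\dots,b_d)$ defining $q$. $M$ has the VCd property if every finite $\Delta(x;y)$ with $|x|=1$ has UDTFS in $d$ parameters. -}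

module Defs where

open import Data.Nat using (ℕ; zero; suc)
open import Data.Fin using (Fin; zero; suc)
open import Data.Fin.Properties using (_≟_)
open import Data.Bool using (Bool; true; false; _∧_; _∨_; not)
open import Data.Maybe using (Maybe; nothing; just; maybe)
open import Data.Product using (Σ; _×_; _,_)
open import Relation.Nullary.Decidable using (does)
open import Relation.Binary.PropositionalEquality using (_≡_)

-- The carrier is Fin size (every finite poset is isomorphic to one
-- of this form); '<' is interpreted by a Boolean-valued strict
-- partial order, so satisfaction below is the classical one.

record FinPoset : Set where
  field
    size    : ℕ
    lt      : Fin size → Fin size → Bool
    irrefl  : ∀ a → lt a a ≡ false
    trans   : ∀ a b c → lt a b ≡ true → lt b c ≡ true → lt a c ≡ true

open FinPoset public

data Formula (V : Set) : Set where
  ⊤f ⊥f  : Formula V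
  _<f_   : V → V → Formula V
  _=f_   : V → V → Formula V
  ¬f_    : Formula V → Formula V
  _∧f_   : Formula V → Formula V → Formula V
  _∨f_   : Formula V → Formula V → Formula V
  ∃f     : Formula (Maybe V) → Formula V   -- 'nothing' is the bound variable
  ∀f     : Formula (Maybe V) → Formula V

anyFin : ∀ {k} → (Fin k → Bool) → Bool
anyFin {zero}  f = false
anyFin {suc k} f = f zero ∨ anyFin (λ i → f (suc i))

allFin : ∀ {k} → (Fin k → Bool) → Bool
allFin {zero}  f = true
allFin {suc k} f = f zero ∧ allFin (λ i → f (suc i))

extend : ∀ {V : Set} {A : Set} → (V → A) → A → Maybe V → A
extend s a = maybe s a

⟦_⟧ : ∀ {V} → Formula V → (M : FinPoset) → (V → Fin (size M)) → Bool
⟦ ⊤f ⟧     M s = true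
⟦ ⊥f ⟧     M s = false
⟦ u <f v ⟧ M s = lt M (s u) (s v)
⟦ u =f v ⟧ M s = does (s u ≟ s v)
⟦ ¬f φ ⟧   M s = not (⟦ φ ⟧ M s)
⟦ φ ∧f ψ ⟧ M s = ⟦ φ ⟧ M s ∧ ⟦ ψ ⟧ M s
⟦ φ ∨f ψ ⟧ M s = ⟦ φ ⟧ M s ∨ ⟦ ψ ⟧ M s
⟦ ∃f φ ⟧   M s = anyFin (λ a → ⟦ φ ⟧ M (extend s a))
⟦ ∀f φ ⟧   M s = allFin (λ a → ⟦ φ ⟧ M (extend s a))

-- Partitioned formulas φ(x;y) with |x| = 1 and |y| = p:
-- free variables Maybe (Fin p), 'nothing' = x, 'just j' = y_j.

PFormula : ℕ → Set
PFormula p = Formula (Maybe (Fin p))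

Tuple : FinPoset → ℕ → Set
Tuple M p = Fin p → Fin (size M)

holds : ∀ {p} (M : FinPoset) → PFormula p → Fin (size M) → Tuple M p → Bool
holds M φ a b = ⟦ φ ⟧ M (extend b a)

-- A finite B ⊆ M^p is given by an enumeration B : Fin n → Tuple M p.
-- A Δ-type over B is a choice q i j ∈ {true,false} of φ_i(x;B j) or
-- ¬φ_i(x;B j) for all i, j; it is in S^Δ(B) iff it is consistent with
-- the elementary diagram of M, which (q being finite and M finite) means
-- it is realised in M.
InS : ∀ {p r n} (M : FinPoset) (Δ : Fin r → PFormula p)
      (B : Fin n → Tuple M p) (q : Fin r → Fin n → Bool) → Set
InS {p} {r} {n} M Δ B q =
  Σ (Fin (size M)) λ a → ∀ (i : Fin r) (j : Fin n) → q i j ≡ holds M (Δ i) a (B j)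

-- Formulas φ_i(y; y_1, ..., y_d) with |y| = |y_l| = p:
-- free variables (nothing , j) = y_j and (just l , j) = (y_{l+1})_j.
DFormula : ℕ → ℕ → Set
DFormula d p = Formula (Maybe (Fin d) × Fin p)

paramVal : ∀ {M : FinPoset} {d p} → Tuple M p → (Fin d → Tuple M p)
           → (Maybe (Fin d) × Fin p) → Fin (size M)
paramVal b bs (nothing , j) = b j
paramVal b bs (just l , j)  = bs l j

Defines : ∀ {d p r n} (M : FinPoset) (F : Fin r → DFormula d p)
          (bs : Fin d → Tuple M p) (B : Fin n → Tuple M p)
          (q : Fin r → Fin n → Bool) → Set
Defines {r = r} {n = n} M F bs B q =
  ∀ (i : Fin r) (j : Fin n) → q i j ≡ ⟦ F i ⟧ M (paramVal {M} (B j) bs)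

-- Δ has UDTFS in d parameters in M.  B ranges over nonempty finite
-- subsets of M^p (B : Fin (suc n) → ...).
UDTFS : ∀ {p r} (d : ℕ) (M : FinPoset) (Δ : Fin r → PFormula p) → Set
UDTFS {p} {r} d M Δ =
  Σ ℕ λ m →
  Σ (Fin m → Fin r → DFormula d p) λ F →
  ∀ (n : ℕ) (B : Fin (suc n) → Tuple M p) (q : Fin r → Fin (suc n) → Bool) →
  InS M Δ B q →
  Σ (Fin d → Fin (suc n)) λ ι →
  Σ (Fin m) λ i → Defines M (F i) (λ l → B (ι l)) B q

VC : ℕ → FinPoset → Set
VC d M = ∀ (p r : ℕ) (Δ : Fin r → PFormula p) → UDTFS d M Δ

-- Take for M the power set of a 2e-element set K = L ⊎ R, |L| = |R| = e = d + 2
-- (so that d < e and {ℓ} ⊊ L for ℓ ∈ L), ordered by strict inclusion; take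
-- Δ = {y < x}, B the singletons of K, and q the type of L over B, so that
-- {k} < x ∈ q iff k ∈ L.  Any d parameters drawn from B meet at most d < e of the
-- e pairs (ℓ, r) ∈ L × R with the same index, so some such pair is untouched.  The
-- transposition of ℓ and r induces an automorphism of M fixing the parameters and
-- exchanging {ℓ} and {r}; formulas are invariant under automorphisms, so no
-- formula with those parameters separates {ℓ} (in q) from {r} (not in q).
module Submission where

open import Defs hiding (trans)
open import Data.Nat using (ℕ)
open import Data.Product using (Σ)
open import Relation.Nullary using (¬_)

open import Data.Nat using (suc; _+_; _^_; _<_)
open import Data.Nat.Properties using (n<1+n; m<n⇒m<1+n)
open import Data.Fin using (Fin; zero; suc; _↑ˡ_; _↑ʳ_; splitAt; combine; funToFin; finToFun)
open import Data.Fin.Properties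
  using (_≟_; 2↔Bool; pigeonhole; any?; all?; ¬∀⟶∃¬; <⇒≢; splitAt-↑ˡ; splitAt-↑ʳ; funToFin-finToFin; finToFun-funToFin)
open import Data.Fin.Permutation
  using (Permutation; Permutation′; _⟨$⟩ʳ_; _⟨$⟩ˡ_; inverseˡ; inverseʳ; permutation; flip; transpose)
open import Data.Bool using (Bool; true; false; _∧_; _∨_; not)
open import Data.Bool.Properties using (∨-zeroʳ; ∧-conicalˡ; ∧-conicalʳ; ¬-not)
open import Data.Maybe using (nothing; just)
open import Data.Empty using (⊥-elim)
open import Data.Product using (_×_; _,_; proj₁; proj₂)
open import Data.Sum using ([_,_]′)
open import Function using (_∘_; id; const)
open import Function.Bundles using (Inverse)
open import Relation.Nullary using (yes; no; does)
open import Relation.Nullary.Decidable using (dec-true; dec-false)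
open import Relation.Binary.PropositionalEquality using (_≡_; _≢_; refl; sym; trans; cong; cong₂; subst₂; module ≡-Reasoning)

open ≡-Reasoning

true≢false : true ≢ false
true≢false ()

bool-ext : ∀ {x y : Bool} → (x ≡ true → y ≡ true) → (y ≡ true → x ≡ true) → x ≡ y
bool-ext {false} {false} _ _ = refl
bool-ext {false} {true}  _ g = g refl
bool-ext {true}  {false} f _ = sym (f refl)
bool-ext {true}  {true}  _ _ = refl

implies-elim : ∀ {x y : Bool} → not x ∨ y ≡ true → x ≡ true → y ≡ true
implies-elim {true} x⇒y refl = x⇒y

implies-intro : ∀ {x y : Bool} → (x ≡ true → y ≡ true) → not x ∨ y ≡ true
implies-intro {false} x⇒y = refl
implies-intro {true}  x⇒y = x⇒y refl

and-not-elim : ∀ {x y : Bool} → x ∧ not y ≡ true → x ≡ true × y ≡ false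
and-not-elim {true} {false} _ = refl , refl

anyFin-intro : ∀ {k} (f : Fin k → Bool) a → f a ≡ true → anyFin f ≡ true
anyFin-intro f zero    fa = cong (_∨ anyFin (f ∘ suc)) fa
anyFin-intro f (suc a) fa = trans (cong (f zero ∨_) (anyFin-intro (f ∘ suc) a fa)) (∨-zeroʳ (f zero))

anyFin-elim : ∀ {k} (f : Fin k → Bool) → anyFin f ≡ true → Σ (Fin k) λ a → f a ≡ true
anyFin-elim {suc k} f any with f zero in f₀≡true
... | true  = zero , f₀≡true
... | false = let a , fa = anyFin-elim (f ∘ suc) any in suc a , fa

allFin-intro : ∀ {k} (f : Fin k → Bool) → (∀ a → f a ≡ true) → allFin f ≡ true
allFin-intro {0}     f all = refl
allFin-intro {suc k} f all = cong₂ _∧_ (all zero) (allFin-intro (f ∘ suc) (all ∘ suc))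

allFin-elim : ∀ {k} (f : Fin k → Bool) → allFin f ≡ true → ∀ a → f a ≡ true
allFin-elim f all zero    = ∧-conicalˡ _ _ all
allFin-elim f all (suc a) = allFin-elim (f ∘ suc) (∧-conicalʳ _ _ all) a

allFin-deMorgan : ∀ {k} (f : Fin k → Bool) → allFin f ≡ not (anyFin (not ∘ f))
allFin-deMorgan {0}     f = refl
allFin-deMorgan {suc k} f with f zero
... | true  = allFin-deMorgan (f ∘ suc)
... | false = refl

anyFin-reindex : ∀ {m n} (π : Permutation m n) {f : Fin m → Bool} {g : Fin n → Bool} →
                 (∀ a → g (π ⟨$⟩ʳ a) ≡ f a) → anyFin g ≡ anyFin f
anyFin-reindex π {f} {g} g∘π≗f = bool-ext g⇒f f⇒g
  where
  g⇒f : anyFin g ≡ true → anyFin f ≡ true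
  g⇒f any = let b , gb = anyFin-elim g any in
    anyFin-intro f (π ⟨$⟩ˡ b) (trans (sym (g∘π≗f _)) (trans (cong g (inverseʳ π)) gb))
  f⇒g : anyFin f ≡ true → anyFin g ≡ true
  f⇒g any = let a , fa = anyFin-elim f any in
    anyFin-intro g (π ⟨$⟩ʳ a) (trans (g∘π≗f a) fa)

allFin-reindex : ∀ {m n} (π : Permutation m n) {f : Fin m → Bool} {g : Fin n → Bool} →
                 (∀ a → g (π ⟨$⟩ʳ a) ≡ f a) → allFin g ≡ allFin f
allFin-reindex π {f} {g} g∘π≗f = begin
  allFin g                 ≡⟨ allFin-deMorgan g ⟩
  not (anyFin (not ∘ g))   ≡⟨ cong not (anyFin-reindex π (cong not ∘ g∘π≗f)) ⟩
  not (anyFin (not ∘ f))   ≡⟨ allFin-deMorgan f ⟨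
  allFin f                 ∎

does-≟-⟨$⟩ʳ : ∀ {m n} (π : Permutation m n) a b → does (π ⟨$⟩ʳ a ≟ b) ≡ does (a ≟ π ⟨$⟩ˡ b)
does-≟-⟨$⟩ʳ π a b with a ≟ π ⟨$⟩ˡ b
... | yes refl = dec-true (_ ≟ b) (inverseʳ π)
... | no a≢π⁻¹b = dec-false (_ ≟ b) λ πa≡b → a≢π⁻¹b (trans (sym (inverseˡ π)) (cong (π ⟨$⟩ˡ_) πa≡b))

does-≟-invariant : ∀ {m n} (π : Permutation m n) a b → does (π ⟨$⟩ʳ a ≟ π ⟨$⟩ʳ b) ≡ does (a ≟ b)
does-≟-invariant π a b = trans (does-≟-⟨$⟩ʳ π a _) (cong (does ∘ (a ≟_)) (inverseˡ π))

transpose-fixes : ∀ {n} (i j k : Fin n) → k ≢ i → k ≢ j → transpose i j ⟨$⟩ʳ k ≡ k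
transpose-fixes i j k k≢i k≢j rewrite dec-false (k ≟ i) k≢i | dec-false (k ≟ j) k≢j = refl

transpose-moves : ∀ {n} (i j : Fin n) → transpose i j ⟨$⟩ʳ i ≡ j
transpose-moves i j rewrite dec-true (i ≟ i) refl = refl

∃-∉-image : ∀ {m n} → m < n → (g : Fin m → Fin n) → Σ (Fin n) λ c → ∀ l → g l ≢ c
∃-∉-image {m} {n} m<n g with all? (λ c → any? (λ l → g l ≟ c))
... | yes surjective =
  let i , j , i<j , same = pigeonhole m<n (proj₁ ∘ surjective) in
  ⊥-elim (<⇒≢ i<j (trans (sym (proj₂ (surjective i))) (trans (cong g same) (proj₂ (surjective j)))))
... | no ¬surjective =
  let c , c∉ = ¬∀⟶∃¬ n _ (λ c → any? (λ l → g l ≟ c)) ¬surjective in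
  c , λ l glc → c∉ (l , glc)

record Automorphism (M : FinPoset) : Set where
  field
    perm         : Permutation′ (size M)
    lt-invariant : ∀ a b → lt M (perm ⟨$⟩ʳ a) (perm ⟨$⟩ʳ b) ≡ lt M a b

open Automorphism

extend-shift : ∀ {V A : Set} (f : A → A) {s s' : V → A} → (∀ v → s' v ≡ f (s v)) →
               ∀ a w → extend s' (f a) w ≡ f (extend s a w)
extend-shift f s'≗fs a nothing  = refl
extend-shift f s'≗fs a (just v) = s'≗fs v

⟦⟧-invariant : ∀ {V} {M : FinPoset} (A : Automorphism M) (φ : Formula V) {s s' : V → Fin (size M)} →
               (∀ v → s' v ≡ perm A ⟨$⟩ʳ s v) → ⟦ φ ⟧ M s' ≡ ⟦ φ ⟧ M s
⟦⟧-invariant A ⊤f        h = refl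
⟦⟧-invariant A ⊥f        h = refl
⟦⟧-invariant {M = M} A (u <f v) {s} h =
  trans (cong₂ (lt M) (h u) (h v)) (lt-invariant A (s u) (s v))
⟦⟧-invariant A (u =f v)  {s} h =
  trans (cong₂ (λ a b → does (a ≟ b)) (h u) (h v)) (does-≟-invariant (perm A) (s u) (s v))
⟦⟧-invariant A (¬f φ)    h = cong not (⟦⟧-invariant A φ h)
⟦⟧-invariant A (φ ∧f ψ)  h = cong₂ _∧_ (⟦⟧-invariant A φ h) (⟦⟧-invariant A ψ h)
⟦⟧-invariant A (φ ∨f ψ)  h = cong₂ _∨_ (⟦⟧-invariant A φ h) (⟦⟧-invariant A ψ h)
⟦⟧-invariant A (∃f φ)    h =
  anyFin-reindex (perm A) λ a → ⟦⟧-invariant A φ (extend-shift (perm A ⟨$⟩ʳ_) h a)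
⟦⟧-invariant A (∀f φ)    h =
  allFin-reindex (perm A) λ a → ⟦⟧-invariant A φ (extend-shift (perm A ⟨$⟩ʳ_) h a)

definedType-invariant :
  ∀ {d p r n} {M : FinPoset} (A : Automorphism M) {F : Fin r → DFormula d p}
  {bs : Fin d → Tuple M p} {B : Fin n → Tuple M p} {q : Fin r → Fin n → Bool} →
  Defines M F bs B q → (∀ l k → perm A ⟨$⟩ʳ bs l k ≡ bs l k) →
  ∀ {j j'} → (∀ k → B j' k ≡ perm A ⟨$⟩ʳ B j k) → ∀ i → q i j' ≡ q i j
definedType-invariant {M = M} A {F} {bs} {B} {q} defines bs-fixed {j} {j'} Bj↦Bj' i = begin
  q i j'                                ≡⟨ defines i j' ⟩
  ⟦ F i ⟧ M (paramVal {M} (B j') bs)    ≡⟨ ⟦⟧-invariant A (F i) moved ⟩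
  ⟦ F i ⟧ M (paramVal {M} (B j) bs)     ≡⟨ defines i j ⟨
  q i j                                 ∎
  where
  moved : ∀ w → paramVal {M} (B j') bs w ≡ perm A ⟨$⟩ʳ paramVal {M} (B j) bs w
  moved (nothing , k) = Bj↦Bj' k
  moved (just l , k)  = sym (bs-fixed l k)

funToFin-cong : ∀ {m n} {f g : Fin m → Fin n} → (∀ t → f t ≡ g t) → funToFin f ≡ funToFin g
funToFin-cong {0}     f≗g = refl
funToFin-cong {suc m} f≗g = cong₂ combine (f≗g zero) (funToFin-cong (f≗g ∘ suc))

module PowerSet (K : ℕ) where

  -- A subset of Fin K is coded by its characteristic function Fin K → Fin 2 ≅ Bool.
  Code : Set
  Code = Fin (2 ^ K)

  infix 4.5 _∈ᵇ_ _⊆ᵇ_ _⊂ᵇ_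

  _∈ᵇ_ : Fin K → Code → Bool
  t ∈ᵇ X = Inverse.to 2↔Bool (finToFun X t)

  fromPredicate : (Fin K → Bool) → Code
  fromPredicate P = funToFin (Inverse.from 2↔Bool ∘ P)

  ∈ᵇ-fromPredicate : ∀ P t → t ∈ᵇ fromPredicate P ≡ P t
  ∈ᵇ-fromPredicate P t =
    trans (cong (Inverse.to 2↔Bool) (finToFun-funToFin _ t)) (Inverse.strictlyInverseˡ 2↔Bool (P t))

  code-ext : ∀ {X Y} → (∀ t → t ∈ᵇ X ≡ t ∈ᵇ Y) → X ≡ Y
  code-ext {X} {Y} same = begin
    X                             ≡⟨ funToFin-finToFin {K} {2} X ⟨
    funToFin {K} {2} (finToFun X) ≡⟨ funToFin-cong sameCharacteristic ⟩
    funToFin {K} {2} (finToFun Y) ≡⟨ funToFin-finToFin {K} {2} Y ⟩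
    Y                             ∎
    where
    open Inverse 2↔Bool using (to; from; strictlyInverseʳ)
    sameCharacteristic : ∀ t → finToFun X t ≡ finToFun Y t
    sameCharacteristic t = begin
      finToFun X t              ≡⟨ strictlyInverseʳ _ ⟨
      from (to (finToFun X t))  ≡⟨ cong from (same t) ⟩
      from (to (finToFun Y t))  ≡⟨ strictlyInverseʳ _ ⟩
      finToFun Y t              ∎

  _⊆ᵇ_ : Code → Code → Bool
  X ⊆ᵇ Y = allFin λ t → not (t ∈ᵇ X) ∨ (t ∈ᵇ Y)

  ⊆ᵇ-elim : ∀ {X Y} → X ⊆ᵇ Y ≡ true → ∀ t → t ∈ᵇ X ≡ true → t ∈ᵇ Y ≡ true
  ⊆ᵇ-elim X⊆Y t = implies-elim (allFin-elim _ X⊆Y t)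

  ⊆ᵇ-intro : ∀ {X Y} → (∀ t → t ∈ᵇ X ≡ true → t ∈ᵇ Y ≡ true) → X ⊆ᵇ Y ≡ true
  ⊆ᵇ-intro X⊆Y = allFin-intro _ (implies-intro ∘ X⊆Y)

  ⊆ᵇ-refute : ∀ {X Y} t → t ∈ᵇ X ≡ true → t ∈ᵇ Y ≡ false → X ⊆ᵇ Y ≡ false
  ⊆ᵇ-refute t t∈X t∉Y = ¬-not λ X⊆Y → true≢false (trans (sym (⊆ᵇ-elim X⊆Y t t∈X)) t∉Y)

  _⊂ᵇ_ : Code → Code → Bool
  X ⊂ᵇ Y = (X ⊆ᵇ Y) ∧ not (Y ⊆ᵇ X)

  ⊂ᵇ-intro : ∀ {X Y} → X ⊆ᵇ Y ≡ true → Y ⊆ᵇ X ≡ false → X ⊂ᵇ Y ≡ true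
  ⊂ᵇ-intro X⊆Y Y⊈X = cong₂ (λ a b → a ∧ not b) X⊆Y Y⊈X

  ⊂ᵇ-irrefl : ∀ X → X ⊂ᵇ X ≡ false
  ⊂ᵇ-irrefl X = cong (λ b → b ∧ not b) (⊆ᵇ-intro {X} λ _ → id)

  ⊂ᵇ-trans : ∀ X Y Z → X ⊂ᵇ Y ≡ true → Y ⊂ᵇ Z ≡ true → X ⊂ᵇ Z ≡ true
  ⊂ᵇ-trans X Y Z X⊂Y Y⊂Z with and-not-elim {X ⊆ᵇ Y} X⊂Y | and-not-elim {Y ⊆ᵇ Z} Y⊂Z
  ... | X⊆Y , Y⊈X | Y⊆Z , _ = ⊂ᵇ-intro (⊆ᵇ-intro X⊆Z) (¬-not Z⊈X)
    where
    X⊆Z : ∀ t → t ∈ᵇ X ≡ true → t ∈ᵇ Z ≡ true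
    X⊆Z t = ⊆ᵇ-elim Y⊆Z t ∘ ⊆ᵇ-elim X⊆Y t
    Z⊈X : Z ⊆ᵇ X ≢ true
    Z⊈X Z⊆X with trans (sym Y⊈X) (⊆ᵇ-intro λ t → ⊆ᵇ-elim Z⊆X t ∘ ⊆ᵇ-elim Y⊆Z t)
    ... | ()

  ℘ : FinPoset
  ℘ = record { size = 2 ^ K ; lt = _⊂ᵇ_ ; irrefl = ⊂ᵇ-irrefl ; trans = ⊂ᵇ-trans }

  image : Permutation′ K → Code → Code
  image π X = fromPredicate λ t → π ⟨$⟩ˡ t ∈ᵇ X

  ∈ᵇ-image : ∀ π X t → t ∈ᵇ image π X ≡ π ⟨$⟩ˡ t ∈ᵇ X
  ∈ᵇ-image π X = ∈ᵇ-fromPredicate _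

  image-inverse : ∀ π X → image (flip π) (image π X) ≡ X
  image-inverse π X = code-ext λ t → begin
    t ∈ᵇ image (flip π) (image π X) ≡⟨ ∈ᵇ-image (flip π) _ t ⟩
    π ⟨$⟩ʳ t ∈ᵇ image π X           ≡⟨ ∈ᵇ-image π X _ ⟩
    π ⟨$⟩ˡ (π ⟨$⟩ʳ t) ∈ᵇ X          ≡⟨ cong (_∈ᵇ X) (inverseˡ π) ⟩
    t ∈ᵇ X                          ∎

  image-mono : ∀ π {X Y} → X ⊆ᵇ Y ≡ true → image π X ⊆ᵇ image π Y ≡ true
  image-mono π {X} {Y} X⊆Y = ⊆ᵇ-intro λ t t∈πX →
    trans (∈ᵇ-image π Y t) (⊆ᵇ-elim X⊆Y _ (trans (sym (∈ᵇ-image π X t)) t∈πX))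

  ⊆ᵇ-image : ∀ π X Y → image π X ⊆ᵇ image π Y ≡ X ⊆ᵇ Y
  ⊆ᵇ-image π X Y = bool-ext
    (subst₂ (λ X′ Y′ → X′ ⊆ᵇ Y′ ≡ true) (image-inverse π X) (image-inverse π Y) ∘ image-mono (flip π))
    (image-mono π)

  image-automorphism : Permutation′ K → Automorphism ℘
  image-automorphism π = record
    { perm         = permutation (image π) (image (flip π)) (image-inverse (flip π)) (image-inverse π)
    ; lt-invariant = λ X Y → cong₂ (λ a b → a ∧ not b) (⊆ᵇ-image π X Y) (⊆ᵇ-image π Y X)
    }

  singleton : Fin K → Code
  singleton j = fromPredicate λ t → does (t ≟ j)

  ∈ᵇ-singleton : ∀ t j → t ∈ᵇ singleton j ≡ does (t ≟ j)
  ∈ᵇ-singleton t j = ∈ᵇ-fromPredicate _ t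

  ∈ᵇ-singleton⇒≡ : ∀ {t j} → t ∈ᵇ singleton j ≡ true → t ≡ j
  ∈ᵇ-singleton⇒≡ {t} {j} t∈[j] with t ≟ j | trans (sym (∈ᵇ-singleton t j)) t∈[j]
  ... | yes t≡j | _ = t≡j

  image-singleton : ∀ π j → image π (singleton j) ≡ singleton (π ⟨$⟩ʳ j)
  image-singleton π j = code-ext λ t → begin
    t ∈ᵇ image π (singleton j)   ≡⟨ ∈ᵇ-image π _ t ⟩
    π ⟨$⟩ˡ t ∈ᵇ singleton j      ≡⟨ ∈ᵇ-singleton _ j ⟩
    does (π ⟨$⟩ˡ t ≟ j)          ≡⟨ does-≟-⟨$⟩ʳ (flip π) t j ⟩
    does (t ≟ π ⟨$⟩ʳ j)          ≡⟨ ∈ᵇ-singleton t _ ⟨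
    t ∈ᵇ singleton (π ⟨$⟩ʳ j)    ∎

  singleton-⊆ᵇ : ∀ {j X} → j ∈ᵇ X ≡ true → singleton j ⊆ᵇ X ≡ true
  singleton-⊆ᵇ {X = X} j∈X = ⊆ᵇ-intro λ t t∈[j] → trans (cong (_∈ᵇ X) (∈ᵇ-singleton⇒≡ t∈[j])) j∈X

  singleton-⊂ᵇ : ∀ {j t X} → j ∈ᵇ X ≡ true → t ∈ᵇ X ≡ true → t ≢ j → singleton j ⊂ᵇ X ≡ true
  singleton-⊂ᵇ {j} {t} j∈X t∈X t≢j =
    ⊂ᵇ-intro (singleton-⊆ᵇ j∈X) (⊆ᵇ-refute t t∈X (trans (∈ᵇ-singleton t j) (dec-false (t ≟ j) t≢j)))

  singleton-⊄ᵇ : ∀ {j X} → j ∈ᵇ X ≡ false → singleton j ⊂ᵇ X ≡ false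
  singleton-⊄ᵇ {j} {X} j∉X =
    cong (_∧ not (X ⊆ᵇ singleton j)) (⊆ᵇ-refute j (trans (∈ᵇ-singleton j j) (dec-true (j ≟ j) refl)) j∉X)

module Counterexample (d : ℕ) where

  e K : ℕ
  e = suc (suc d)
  K = e + e

  open PowerSet K

  left right : Fin e → Fin K
  left c  = c ↑ˡ e
  right c = e ↑ʳ c

  column : Fin K → Fin e
  column t = [ id , id ]′ (splitAt e t)

  column-left : ∀ c → column (left c) ≡ c
  column-left c = cong [ id , id ]′ (splitAt-↑ˡ e c e)

  column-right : ∀ c → column (right c) ≡ c
  column-right c = cong [ id , id ]′ (splitAt-↑ʳ e e c)

  isLeft : Fin K → Bool
  isLeft t = [ const true , const false ]′ (splitAt e t)

  leftHalf : Code
  leftHalf = fromPredicate isLeft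

  left∈leftHalf : ∀ c → left c ∈ᵇ leftHalf ≡ true
  left∈leftHalf c = trans (∈ᵇ-fromPredicate isLeft (left c)) (cong [ const true , const false ]′ (splitAt-↑ˡ e c e))

  right∉leftHalf : ∀ c → right c ∈ᵇ leftHalf ≡ false
  right∉leftHalf c = trans (∈ᵇ-fromPredicate isLeft (right c)) (cong [ const true , const false ]′ (splitAt-↑ʳ e e c))

  another : Fin e → Fin e
  another zero    = suc zero
  another (suc _) = zero

  another-≢ : ∀ c → left (another c) ≢ left c
  another-≢ zero    ()
  another-≢ (suc c) ()

  Δ : Fin 1 → PFormula 1
  Δ _ = just zero <f nothing

  singletons : Fin K → Tuple ℘ 1
  singletons j _ = singleton j

  typeOfLeftHalf : Fin 1 → Fin K → Bool
  typeOfLeftHalf _ j = singleton j ⊂ᵇ leftHalf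

  left∈type : ∀ c → typeOfLeftHalf zero (left c) ≡ true
  left∈type c = singleton-⊂ᵇ (left∈leftHalf c) (left∈leftHalf (another c)) (another-≢ c)

  right∉type : ∀ c → typeOfLeftHalf zero (right c) ≡ false
  right∉type c = singleton-⊄ᵇ {right c} {leftHalf} (right∉leftHalf c)

  ≢-column : ∀ {t c} → column t ≢ c → t ≢ left c × t ≢ right c
  ≢-column {c = c} t≉c =
    (λ t≡ → t≉c (trans (cong column t≡) (column-left c))) ,
    (λ t≡ → t≉c (trans (cong column t≡) (column-right c)))

  ¬UDTFS : ¬ UDTFS d ℘ Δ
  ¬UDTFS (_ , F , udtfs) with udtfs _ singletons typeOfLeftHalf (leftHalf , λ _ _ → refl)
  ... | ι , i , defines = true≢false (begin
    true                            ≡⟨ left∈type c ⟨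
    typeOfLeftHalf zero (left c)    ≡⟨ undistinguished ⟨
    typeOfLeftHalf zero (right c)   ≡⟨ right∉type c ⟩
    false                           ∎)
    where
    unusedColumn : Σ (Fin e) λ c → ∀ l → column (ι l) ≢ c
    unusedColumn = ∃-∉-image (m<n⇒m<1+n (n<1+n d)) (column ∘ ι)

    c : Fin e
    c = proj₁ unusedColumn

    τ : Permutation′ K
    τ = transpose (left c) (right c)

    parameters-fixed : ∀ l (_ : Fin 1) → image τ (singleton (ι l)) ≡ singleton (ι l)
    parameters-fixed l _ = let ιl≢left , ιl≢right = ≢-column (proj₂ unusedColumn l) in
      trans (image-singleton τ (ι l)) (cong singleton (transpose-fixes (left c) (right c) (ι l) ιl≢left ιl≢right))

    left↦right : ∀ (_ : Fin 1) → singleton (right c) ≡ image τ (singleton (left c))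
    left↦right _ = trans (cong singleton (sym (transpose-moves (left c) (right c)))) (sym (image-singleton τ (left c)))

    undistinguished : typeOfLeftHalf zero (right c) ≡ typeOfLeftHalf zero (left c)
    undistinguished = definedType-invariant (image-automorphism τ) {F = F i} {B = singletons} {q = typeOfLeftHalf}
      defines parameters-fixed {left c} {right c} left↦right zero

  ¬VC : ¬ VC d ℘
  ¬VC vc = ¬UDTFS (vc 1 1 Δ)

mainTheorem7 : ¬ (Σ ℕ λ d → ∀ (M : FinPoset) → VC d M)
mainTheorem7 (d , vc) = ¬VC (vc _)
  where open Counterexample d
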